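{- Let $q$ be a prime power, $d\ge 2$, $n=d^2-1$, $s$ with $\gcd(s,n)=1$, $\sigma\colon x\mapsto x^{q^s}$ on $\mathbb{F}_{q^n}$, and let $a\in\mathbb{F}_{q^n}^*$, $b=a^{ -\sigma^d\frac{\sigma^{d(d-1)}-1}{\sigma^d-1}}$. Then $a^{\sigma^d}b=a^{\sigma}b^{\sigma^d}$, hence $a^{\sigma^{k-1}}b^{\sigma^{k-d-1}}=a^{\sigma^{k-d}}b^{\sigma^{k-1}}$ for every integer $k\geq d+1$. Moreover, for every $r\in\{1,\ldots,d-1\}$ and every integer $u\leq r-1$, \[ b^{\sigma^{d(r-u)+u-1}}\,a^{ -\sum_{i=1}^{r-u}\sigma^{id+(u-1)}}=a^{ -\sigma^u}\,b^{\sigma^{u-1}}\,a^{ -\sum_{i=1}^{r-u-1}\sigma^{id+u}}. \]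
   Context: $\sigma^j$ for an integer $j$ is the $j$-th power of $\sigma$ in the Galois group (so $\sigma^n=\mathrm{id}$); $a^{\sigma^j}=\sigma^j(a)$, $a^{\sum_i e_i\sigma^{j_i}}=\prod_i\sigma^{j_i}(a)^{e_i}$, and $a^{ -\sigma^d\frac{\sigma^{d(d-1)}-1}{\sigma^d-1}}=\prod_{i=1}^{d-1}\sigma^{id}(a)^{ -1}$. Empty sums in exponents are $0$. -}

module Defs where

open import Level using (Level; _⊔_) renaming (suc to lsuc)
open import Algebra.Bundles using (CommutativeRing)
import Algebra.Bundles
import Algebra.Definitions.RawSemiring as RawSemiringDefs
open import Data.Nat using (ℕ; zero; suc)
import Data.Nat as ℕ
open import Data.Nat.Primality using (Prime)
open import Data.Integer using (ℤ; +_; -[1+_])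
open import Data.Fin using (Fin)
open import Data.Product using (Σ; _×_)
open import Function.Base using (_∘_)
open import Function.Bundles using (Bijection)
open import Relation.Binary.PropositionalEquality using (_≡_; setoid)
open import Relation.Nullary using (¬_)

record Field (c ℓ : Level) : Set (lsuc (c ⊔ ℓ)) where
  field
    commutativeRing : CommutativeRing c ℓ
  open CommutativeRing commutativeRing public
  field
    inv       : Carrier → Carrier
    0≉1       : ¬ (0# ≈ 1#)
    inverseʳ  : ∀ x → ¬ (x ≈ 0#) → (x * inv x) ≈ 1#

  open RawSemiringDefs (Algebra.Bundles.Semiring.rawSemiring semiring) public using (_^_)

IsPrimePower : ℕ → Set
IsPrimePower q = Σ ℕ λ p → Σ ℕ λ e → Prime p × (1 ℕ.≤ e) × (q ≡ p ℕ.^ e)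

HasCard : ∀ {c ℓ} → Field c ℓ → ℕ → Set (c ⊔ ℓ)
HasCard F m = Bijection (Field.setoid F) (setoid (Fin m))

iter : ∀ {a} {A : Set a} → (A → A) → ℕ → A → A
iter f zero    x = x
iter f (suc m) x = f (iter f m x)

-- Integer powers σ^j of an automorphism σ of order dividing n
-- (σ^n = id), using σ^{-1} = σ^{n-1}.
powℤ : ∀ {a} {A : Set a} → ℕ → (A → A) → ℤ → A → A
powℤ n σ (+ m)      = iter σ m
powℤ n σ (-[1+ m ]) = iter σ ((n ℕ.∸ 1) ℕ.* suc m)

module _ {c ℓ} (F : Field c ℓ) where
  open Field F

  prodInv : (ℕ → Carrier) → ℕ → Carrier
  prodInv f zero    = 1#
  prodInv f (suc m) = prodInv f m * inv (f (suc m))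

-- Every element of a field with N elements satisfies x ^ N = x (multiplication
-- by a nonzero a permutes the elements), so the Frobenius power σ has order
-- dividing n and its integer powers form an action of ℤ by multiplicative maps.
-- Since d * d = n + 1, σ^d maps the factors σ^(i d)(a)⁻¹ of b (1 ≤ i ≤ d - 1)
-- to the next ones and the last one to σ^(d d)(a)⁻¹ = σ(a)⁻¹; this telescoping
-- gives a^(σ^d) b = a^σ b^(σ^d).  Applying σ^t to it gives the relation at every
-- shift t, and peeling off the factors of the product one at a time yields the
-- last identity.

module Submission where

open import Defs
open import Level using (_⊔_)
open import Data.Nat using (ℕ; zero; suc)
import Data.Nat as ℕ
import Data.Nat.Properties as ℕP
open import Data.Nat.GCD using (gcd)
open import Data.Integer using (ℤ; +_; -[1+_])
import Data.Integer as ℤ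
import Data.Integer.Properties as ℤP
open import Data.Integer.Tactic.RingSolver using (solve-∀)
open import Data.Fin using (Fin; punchIn; _≟_)
import Data.Fin as Fin
open import Data.Fin.Properties using (punchInᵢ≢i)
import Data.Fin.Permutation as Perm
open import Data.Product using (_×_; _,_; proj₁; proj₂)
open import Function.Base using (_∘_)
open import Function.Bundles using (Bijection)
open import Relation.Binary.PropositionalEquality as ≡ using (_≡_)
open import Relation.Nullary using (¬_; Dec; yes; no)
open import Relation.Nullary.Decidable using (map′)
open import Relation.Nullary.Negation using (contradiction)
import Algebra.Properties.CommutativeSemiring.Exp as Exp
import Algebra.Properties.CommutativeMonoid.Sum as Product

module Exponent (n′ : ℕ) where
  open ≡.≡-Reasoning

  n : ℕ
  n = suc n′

  exponent : ℤ → ℕ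
  exponent (+ m)    = m
  exponent -[1+ m ] = n′ ℕ.* suc m

  wraps : ℤ → ℕ
  wraps (+ m)    = 0
  wraps -[1+ m ] = suc m

  pos-+-* : ∀ a b c → + (a ℕ.+ b ℕ.* c) ≡ + a ℤ.+ + b ℤ.* + c
  pos-+-* a b c = ≡.trans (ℤP.pos-+ a (b ℕ.* c)) (≡.cong (λ bc → + a ℤ.+ bc) (ℤP.pos-* b c))

  exponent-≡ : ∀ j → + exponent j ≡ j ℤ.+ + wraps j ℤ.* + n
  exponent-≡ (+ m)    = ≡.sym (ℤP.+-identityʳ (+ m))
  exponent-≡ -[1+ m ] = begin
    + (n′ ℕ.* suc m)                         ≡⟨ ℤP.pos-* n′ (suc m) ⟩
    + n′ ℤ.* + suc m                         ≡⟨ regroup (+ n′) (+ suc m) ⟩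
    ℤ.- + suc m ℤ.+ + suc m ℤ.* (+ 1 ℤ.+ + n′) ≡⟨ ≡.cong (λ k → -[1+ m ] ℤ.+ + suc m ℤ.* k) (ℤP.pos-+ 1 n′) ⟨
    -[1+ m ] ℤ.+ + suc m ℤ.* + n             ∎
    where
    regroup : ∀ N K → N ℤ.* K ≡ ℤ.- K ℤ.+ K ℤ.* (+ 1 ℤ.+ N)
    regroup = solve-∀

  exponent-+ : ∀ i j → exponent (i ℤ.+ j) ℕ.+ (wraps i ℕ.+ wraps j) ℕ.* n
                     ≡ exponent i ℕ.+ exponent j ℕ.+ wraps (i ℤ.+ j) ℕ.* n
  exponent-+ i j = ℤP.+-injective (begin
    + (exponent (i ℤ.+ j) ℕ.+ (wraps i ℕ.+ wraps j) ℕ.* n)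
      ≡⟨ pos-+-* (exponent (i ℤ.+ j)) (wraps i ℕ.+ wraps j) n ⟩
    + exponent (i ℤ.+ j) ℤ.+ + (wraps i ℕ.+ wraps j) ℤ.* + n
      ≡⟨ ≡.cong₂ (λ e w → e ℤ.+ w ℤ.* + n) (exponent-≡ (i ℤ.+ j)) (ℤP.pos-+ (wraps i) (wraps j)) ⟩
    (i ℤ.+ j ℤ.+ + wraps (i ℤ.+ j) ℤ.* + n) ℤ.+ (+ wraps i ℤ.+ + wraps j) ℤ.* + n
      ≡⟨ regroup i j (+ wraps i) (+ wraps j) (+ wraps (i ℤ.+ j)) (+ n) ⟩
    (i ℤ.+ + wraps i ℤ.* + n) ℤ.+ (j ℤ.+ + wraps j ℤ.* + n) ℤ.+ + wraps (i ℤ.+ j) ℤ.* + n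
      ≡⟨ ≡.cong₂ (λ eᵢ eⱼ → eᵢ ℤ.+ eⱼ ℤ.+ + wraps (i ℤ.+ j) ℤ.* + n) (exponent-≡ i) (exponent-≡ j) ⟨
    + exponent i ℤ.+ + exponent j ℤ.+ + wraps (i ℤ.+ j) ℤ.* + n
      ≡⟨ ≡.cong (λ e → e ℤ.+ + wraps (i ℤ.+ j) ℤ.* + n) (ℤP.pos-+ (exponent i) (exponent j)) ⟨
    + (exponent i ℕ.+ exponent j) ℤ.+ + wraps (i ℤ.+ j) ℤ.* + n
      ≡⟨ pos-+-* (exponent i ℕ.+ exponent j) (wraps (i ℤ.+ j)) n ⟨
    + (exponent i ℕ.+ exponent j ℕ.+ wraps (i ℤ.+ j) ℕ.* n) ∎)
    where
    regroup : ∀ i j wᵢ wⱼ w N → (i ℤ.+ j ℤ.+ w ℤ.* N) ℤ.+ (wᵢ ℤ.+ wⱼ) ℤ.* N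
                              ≡ (i ℤ.+ wᵢ ℤ.* N) ℤ.+ (j ℤ.+ wⱼ ℤ.* N) ℤ.+ w ℤ.* N
    regroup = solve-∀

module FieldProperties {c ℓ} (F : Field c ℓ) where
  open Field F hiding (zero; _+_)
  open import Relation.Binary.Reasoning.Setoid setoid
  open import Algebra.Solver.CommutativeMonoid *-commutativeMonoid using (solve; _⊕_; _⊜_)
  open Exp commutativeSemiring using (^-congˡ; ^-congʳ; ^-distrib-*; ^-assocʳ)

  1≉0 : 1# ≉ 0#
  1≉0 1≈0 = 0≉1 (sym 1≈0)

  x*y*y⁻¹≈x : ∀ x {y} → y ≉ 0# → x * y * inv y ≈ x
  x*y*y⁻¹≈x x {y} y≉0 = begin
    x * y * inv y   ≈⟨ *-assoc x y (inv y) ⟩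
    x * (y * inv y) ≈⟨ *-congˡ (inverseʳ y y≉0) ⟩
    x * 1#          ≈⟨ *-identityʳ x ⟩
    x               ∎

  x*y⁻¹*y≈x : ∀ x {y} → y ≉ 0# → x * inv y * y ≈ x
  x*y⁻¹*y≈x x {y} y≉0 = begin
    x * inv y * y   ≈⟨ *-assoc x (inv y) y ⟩
    x * (inv y * y) ≈⟨ *-congˡ (*-comm (inv y) y) ⟩
    x * (y * inv y) ≈⟨ *-assoc x y (inv y) ⟨
    x * y * inv y   ≈⟨ x*y*y⁻¹≈x x y≉0 ⟩
    x               ∎

  *-cancelʳ : ∀ {x y z} → z ≉ 0# → x * z ≈ y * z → x ≈ y
  *-cancelʳ {x} {y} {z} z≉0 xz≈yz = begin
    x             ≈⟨ x*y*y⁻¹≈x x z≉0 ⟨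
    x * z * inv z ≈⟨ *-congʳ xz≈yz ⟩
    y * z * inv z ≈⟨ x*y*y⁻¹≈x y z≉0 ⟩
    y             ∎

  *-≉0 : ∀ {x y} → x ≉ 0# → y ≉ 0# → x * y ≉ 0#
  *-≉0 {x} {y} x≉0 y≉0 xy≈0 =
    y≉0 (*-cancelʳ x≉0 (trans (*-comm y x) (trans xy≈0 (sym (zeroˡ x)))))

  inv-unique : ∀ {x y} → x ≉ 0# → x * y ≈ 1# → y ≈ inv x
  inv-unique {x} {y} x≉0 xy≈1 = *-cancelʳ x≉0 (begin
    y * x     ≈⟨ *-comm y x ⟩
    x * y     ≈⟨ xy≈1 ⟩
    1#        ≈⟨ inverseʳ x x≉0 ⟨
    x * inv x ≈⟨ *-comm x (inv x) ⟩
    inv x * x ∎)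

  -- inv is only known to respect ≈ away from 0
  inv-cong : ∀ {x y} → x ≉ 0# → x ≈ y → inv x ≈ inv y
  inv-cong {x} x≉0 x≈y =
    inv-unique (x≉0 ∘ trans x≈y) (trans (*-congʳ (sym x≈y)) (inverseʳ x x≉0))

  cross-divide : ∀ {x y z w} → y ≉ 0# → z ≉ 0# → x * z ≈ w * y → x * inv y ≈ w * inv z
  cross-divide {x} {y} {z} {w} y≉0 z≉0 xz≈wy = begin
    x * inv y                 ≈⟨ x*y*y⁻¹≈x (x * inv y) z≉0 ⟨
    x * inv y * z * inv z     ≈⟨ *-congʳ (solve 3 (λ x y′ z → (x ⊕ y′) ⊕ z ⊜ (x ⊕ z) ⊕ y′) refl x (inv y) z) ⟩
    x * z * inv y * inv z     ≈⟨ *-congʳ (*-congʳ xz≈wy) ⟩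
    w * y * inv y * inv z     ≈⟨ *-congʳ (x*y*y⁻¹≈x w y≉0) ⟩
    w * inv z                 ∎

  ^-≉0 : ∀ {x} m → x ≉ 0# → x ^ m ≉ 0#
  ^-≉0 zero    x≉0 = 1≉0
  ^-≉0 (suc m) x≉0 = *-≉0 x≉0 (^-≉0 m x≉0)

  prodInv-cong : ∀ {h h′} m → (∀ i → h i ≉ 0#) → (∀ i → h i ≈ h′ i) →
                 prodInv F h m ≈ prodInv F h′ m
  prodInv-cong zero    h≉0 h≈h′ = refl
  prodInv-cong (suc m) h≉0 h≈h′ =
    *-cong (prodInv-cong m h≉0 h≈h′) (inv-cong (h≉0 (suc m)) (h≈h′ (suc m)))

  prodInv-telescope : ∀ {h} m → (∀ i → h i ≉ 0#) →
                      prodInv F h m * h 1 ≈ prodInv F (h ∘ suc) m * h (suc m)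
  prodInv-telescope zero    h≉0 = refl
  prodInv-telescope {h} (suc m) h≉0 = begin
    prodInv F h m * inv (h (suc m)) * h 1
      ≈⟨ solve 3 (λ p y z → (p ⊕ y) ⊕ z ⊜ (p ⊕ z) ⊕ y) refl (prodInv F h m) (inv (h (suc m))) (h 1) ⟩
    prodInv F h m * h 1 * inv (h (suc m))
      ≈⟨ *-congʳ (prodInv-telescope m h≉0) ⟩
    prodInv F (h ∘ suc) m * h (suc m) * inv (h (suc m))
      ≈⟨ x*y*y⁻¹≈x _ (h≉0 (suc m)) ⟩
    prodInv F (h ∘ suc) m
      ≈⟨ x*y⁻¹*y≈x _ (h≉0 (suc (suc m))) ⟨
    prodInv F (h ∘ suc) m * inv (h (suc (suc m))) * h (suc (suc m)) ∎

  record IsMultiplicative (f : Carrier → Carrier) : Set (c ⊔ ℓ) where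
    field
      cong         : ∀ {x y} → x ≈ y → f x ≈ f y
      homo         : ∀ x y → f (x * y) ≈ f x * f y
      preserves-≉0 : ∀ {x} → x ≉ 0# → f x ≉ 0#

    1-fixed : f 1# ≈ 1#
    1-fixed = *-cancelʳ (preserves-≉0 1≉0) (begin
      f 1# * f 1#  ≈⟨ homo 1# 1# ⟨
      f (1# * 1#)  ≈⟨ cong (*-identityˡ 1#) ⟩
      f 1#         ≈⟨ *-identityˡ (f 1#) ⟨
      1# * f 1#    ∎)

    inv-homo : ∀ {x} → x ≉ 0# → f (inv x) ≈ inv (f x)
    inv-homo {x} x≉0 = inv-unique (preserves-≉0 x≉0) (begin
      f x * f (inv x) ≈⟨ homo x (inv x) ⟨
      f (x * inv x)   ≈⟨ cong (inverseʳ x x≉0) ⟩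
      f 1#            ≈⟨ 1-fixed ⟩
      1#              ∎)

    prodInv-homo : ∀ {h} m → (∀ i → h i ≉ 0#) → f (prodInv F h m) ≈ prodInv F (f ∘ h) m
    prodInv-homo zero    h≉0 = 1-fixed
    prodInv-homo (suc m) h≉0 =
      trans (homo _ _) (*-cong (prodInv-homo m h≉0) (inv-homo (h≉0 (suc m))))

  ^-isMultiplicative : ∀ Q → IsMultiplicative (_^ Q)
  ^-isMultiplicative Q = record
    { cong = ^-congˡ Q ; homo = λ x y → ^-distrib-* x y Q ; preserves-≉0 = ^-≉0 Q }

  iter-isMultiplicative : ∀ {f} → IsMultiplicative f → ∀ m → IsMultiplicative (iter f m)
  iter-isMultiplicative f-mult zero = record
    { cong = λ x≈y → x≈y ; homo = λ _ _ → refl ; preserves-≉0 = λ x≉0 → x≉0 }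
  iter-isMultiplicative f-mult (suc m) = record
    { cong         = f.cong ∘ fᵐ.cong
    ; homo         = λ x y → trans (f.cong (fᵐ.homo x y)) (f.homo _ _)
    ; preserves-≉0 = f.preserves-≉0 ∘ fᵐ.preserves-≉0
    }
    where
    module f  = IsMultiplicative f-mult
    module fᵐ = IsMultiplicative (iter-isMultiplicative f-mult m)

  iter-+ : ∀ (f : Carrier → Carrier) m k x → iter f (m ℕ.+ k) x ≡ iter f m (iter f k x)
  iter-+ f zero    k x = ≡.refl
  iter-+ f (suc m) k x = ≡.cong f (iter-+ f m k x)

  iter-^ : ∀ Q m x → iter (_^ Q) m x ≈ x ^ (Q ℕ.^ m)
  iter-^ Q zero    x = sym (*-identityʳ x)
  iter-^ Q (suc m) x = begin
    iter (_^ Q) m x ^ Q   ≈⟨ ^-congˡ Q (iter-^ Q m x) ⟩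
    (x ^ (Q ℕ.^ m)) ^ Q   ≈⟨ ^-assocʳ x (Q ℕ.^ m) Q ⟩
    x ^ (Q ℕ.^ m ℕ.* Q)   ≈⟨ ^-congʳ x (ℕP.*-comm (Q ℕ.^ m) Q) ⟩
    x ^ (Q ℕ.* Q ℕ.^ m)   ∎

  module FiniteField {K} (card : HasCard F (suc K)) where
    open Bijection card using (to; injective)
      renaming (cong to to-cong; strictlySurjective to to-surjective)
    open Product *-commutativeMonoid using ()
      renaming (sum to ∏; sum-cong-≋ to ∏-cong; sum-permute to ∏-permute;
                ∑-distrib-+ to ∏-distrib-*; sum-remove to ∏-remove; sum-replicate to ∏-replicate)

    element : Fin (suc K) → Carrier
    element i = proj₁ (to-surjective i)

    to-element : ∀ i → to (element i) ≡ i
    to-element i = proj₂ (to-surjective i)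

    element-to : ∀ x → element (to x) ≈ x
    element-to x = injective (to-element (to x))

    ≈0? : ∀ x → Dec (x ≈ 0#)
    ≈0? x = map′ injective to-cong (to x ≟ to 0#)

    -- Replacing 0 by 1 makes the product of all elements a nonzero quantity,
    -- and multiplying every element by a multiplies it by a ^ K.
    unit : Carrier → Carrier
    unit x with ≈0? x
    ... | yes _ = 1#
    ... | no  _ = x

    scale : Carrier → Carrier → Carrier
    scale a x with ≈0? x
    ... | yes _ = 1#
    ... | no  _ = a

    unit-cong : ∀ {x y} → x ≈ y → unit x ≈ unit y
    unit-cong {x} {y} x≈y with ≈0? x | ≈0? y
    ... | yes _   | yes _   = refl
    ... | no  _   | no  _   = x≈y
    ... | yes x≈0 | no  y≉0 = contradiction (trans (sym x≈y) x≈0) y≉0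
    ... | no  x≉0 | yes y≈0 = contradiction (trans x≈y y≈0) x≉0

    unit-≉0 : ∀ x → unit x ≉ 0#
    unit-≉0 x with ≈0? x
    ... | yes _   = 1≉0
    ... | no  x≉0 = x≉0

    unit-* : ∀ {a} → a ≉ 0# → ∀ x → unit (a * x) ≈ scale a x * unit x
    unit-* {a} a≉0 x with ≈0? x | ≈0? (a * x)
    ... | yes _   | yes _    = sym (*-identityˡ 1#)
    ... | no  _   | no  _    = refl
    ... | yes x≈0 | no  ax≉0 = contradiction (trans (*-congˡ x≈0) (zeroʳ a)) ax≉0
    ... | no  x≉0 | yes ax≈0 = contradiction ax≈0 (*-≉0 a≉0 x≉0)

    scaling : ∀ {a} → a ≉ 0# → Perm.Permutation (suc K) (suc K)
    scaling {a} a≉0 = Perm.permutation (λ i → to (a * element i)) (λ i → to (inv a * element i))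
      (λ i → ≡.trans (to-cong (trans (*-congˡ (element-to _)) (cancel (inverseʳ a a≉0)))) (to-element i))
      (λ i → ≡.trans (to-cong (trans (*-congˡ (element-to _)) (cancel a⁻¹a≈1))) (to-element i))
      where
      a⁻¹a≈1 : inv a * a ≈ 1#
      a⁻¹a≈1 = trans (*-comm (inv a) a) (inverseʳ a a≉0)
      cancel : ∀ {x y z} → x * y ≈ 1# → x * (y * z) ≈ z
      cancel {x} {y} {z} xy≈1 = trans (sym (*-assoc x y z)) (trans (*-congʳ xy≈1) (*-identityˡ z))

    ∏-scale : ∀ a → ∏ (scale a ∘ element) ≈ a ^ K
    ∏-scale a = begin
      ∏ (scale a ∘ element)                            ≈⟨ ∏-remove {i = to 0#} (scale a ∘ element) ⟩
      scale a (element (to 0#)) * ∏ (scale a ∘ element ∘ punchIn (to 0#))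
        ≈⟨ *-cong scale-0 (∏-cong scale-≉0) ⟩
      1# * ∏ {K} (λ _ → a)                             ≈⟨ *-identityˡ _ ⟩
      ∏ {K} (λ _ → a)                                  ≈⟨ ∏-replicate K ⟩
      a ^ K                                            ∎
      where
      scale-0 : scale a (element (to 0#)) ≈ 1#
      scale-0 with ≈0? (element (to 0#))
      ... | yes _ = refl
      ... | no  ≉0 = contradiction (element-to 0#) ≉0
      scale-≉0 : ∀ j → scale a (element (punchIn (to 0#) j)) ≈ a
      scale-≉0 j with ≈0? (element (punchIn (to 0#) j))
      ... | yes ≈0 = contradiction (≡.trans (≡.sym (to-element _)) (to-cong ≈0)) (punchInᵢ≢i (to 0#) j)
      ... | no  _  = refl

    ∏-≉0 : ∀ {m} (f : Fin m → Carrier) → (∀ i → f i ≉ 0#) → ∏ f ≉ 0#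
    ∏-≉0 {zero}  f f≉0 = 1≉0
    ∏-≉0 {suc m} f f≉0 = *-≉0 (f≉0 Fin.zero) (∏-≉0 (f ∘ Fin.suc) (f≉0 ∘ Fin.suc))

    ^-pred-card≈1 : ∀ {a} → a ≉ 0# → a ^ K ≈ 1#
    ^-pred-card≈1 {a} a≉0 = *-cancelʳ (∏-≉0 (unit ∘ element) (unit-≉0 ∘ element)) (begin
      a ^ K * Π                                               ≈⟨ *-congʳ (∏-scale a) ⟨
      ∏ (scale a ∘ element) * Π                               ≈⟨ ∏-distrib-* (scale a ∘ element) (unit ∘ element) ⟨
      ∏ (λ i → scale a (element i) * unit (element i))        ≈⟨ ∏-cong (λ i → unit-* a≉0 (element i)) ⟨
      ∏ (λ i → unit (a * element i))                          ≈⟨ ∏-cong (λ i → unit-cong (element-to (a * element i))) ⟨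
      ∏ (λ i → unit (element (to (a * element i))))           ≈⟨ ∏-permute (unit ∘ element) (scaling a≉0) ⟨
      Π                                                       ≈⟨ *-identityˡ Π ⟨
      1# * Π                                                  ∎)
      where
      Π : Carrier
      Π = ∏ (unit ∘ element)

    ^-card≈id : ∀ x → x ^ suc K ≈ x
    ^-card≈id x with ≈0? x
    ... | yes x≈0 = trans (*-congʳ x≈0) (trans (zeroˡ _) (sym x≈0))
    ... | no  x≉0 = trans (*-congˡ (^-pred-card≈1 x≉0)) (*-identityʳ x)

  ^-card≈id : ∀ {N} → HasCard F N → ∀ x → x ^ N ≈ x
  ^-card≈id {zero}  card x with Bijection.to card 0#
  ... | ()
  ^-card≈id {suc K} card = FiniteField.^-card≈id card

  ^-card^≈id : ∀ {N} → HasCard F N → ∀ s x → x ^ (N ℕ.^ s) ≈ x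
  ^-card^≈id {N} card zero    x = *-identityʳ x
  ^-card^≈id {N} card (suc s) x = begin
    x ^ (N ℕ.* N ℕ.^ s)   ≈⟨ ^-assocʳ x N (N ℕ.^ s) ⟨
    (x ^ N) ^ (N ℕ.^ s)   ≈⟨ ^-congˡ (N ℕ.^ s) (^-card≈id card x) ⟩
    x ^ (N ℕ.^ s)         ≈⟨ ^-card^≈id card s x ⟩
    x                     ∎

  frobenius-period : ∀ {q n} → HasCard F (q ℕ.^ n) → ∀ s x → iter (_^ (q ℕ.^ s)) n x ≈ x
  frobenius-period {q} {n} card s x = begin
    iter (_^ (q ℕ.^ s)) n x   ≈⟨ iter-^ (q ℕ.^ s) n x ⟩
    x ^ ((q ℕ.^ s) ℕ.^ n)     ≡⟨ ≡.cong (x ^_) (^-comm q s n) ⟩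
    x ^ ((q ℕ.^ n) ℕ.^ s)     ≈⟨ ^-card^≈id card s x ⟩
    x                         ∎
    where
    ^-comm : ∀ q s n → (q ℕ.^ s) ℕ.^ n ≡ (q ℕ.^ n) ℕ.^ s
    ^-comm q s n = ≡.trans (ℕP.^-*-assoc q s n)
      (≡.trans (≡.cong (q ℕ.^_) (ℕP.*-comm s n)) (≡.sym (ℕP.^-*-assoc q n s)))

  module Periodic {σ} (σ-mult : IsMultiplicative σ) (n′ : ℕ)
                  (period : ∀ x → iter σ (suc n′) x ≈ x) where
    open Exponent n′
    module σ = IsMultiplicative σ-mult

    powℤ≡iter : ∀ j x → powℤ n σ j x ≡ iter σ (exponent j) x
    powℤ≡iter (+ m)    x = ≡.refl
    powℤ≡iter -[1+ m ] x = ≡.refl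

    powℤ-isMultiplicative : ∀ j → IsMultiplicative (powℤ n σ j)
    powℤ-isMultiplicative (+ m)    = iter-isMultiplicative σ-mult m
    powℤ-isMultiplicative -[1+ m ] = iter-isMultiplicative σ-mult (exponent -[1+ m ])

    iter-multiple : ∀ k x → iter σ (k ℕ.* n) x ≈ x
    iter-multiple zero    x = refl
    iter-multiple (suc k) x = begin
      iter σ (n ℕ.+ k ℕ.* n) x     ≡⟨ iter-+ σ n (k ℕ.* n) x ⟩
      iter σ n (iter σ (k ℕ.* n) x) ≈⟨ period _ ⟩
      iter σ (k ℕ.* n) x            ≈⟨ iter-multiple k x ⟩
      x                             ∎

    iter-congruent : ∀ {m m′} k k′ → m ℕ.+ k ℕ.* n ≡ m′ ℕ.+ k′ ℕ.* n →
                     ∀ x → iter σ m x ≈ iter σ m′ x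
    iter-congruent {m} {m′} k k′ eq x = begin
      iter σ m x                       ≈⟨ IsMultiplicative.cong (iter-isMultiplicative σ-mult m) (iter-multiple k x) ⟨
      iter σ m (iter σ (k ℕ.* n) x)     ≡⟨ iter-+ σ m (k ℕ.* n) x ⟨
      iter σ (m ℕ.+ k ℕ.* n) x          ≡⟨ ≡.cong (λ e → iter σ e x) eq ⟩
      iter σ (m′ ℕ.+ k′ ℕ.* n) x        ≡⟨ iter-+ σ m′ (k′ ℕ.* n) x ⟩
      iter σ m′ (iter σ (k′ ℕ.* n) x)   ≈⟨ IsMultiplicative.cong (iter-isMultiplicative σ-mult m′) (iter-multiple k′ x) ⟩
      iter σ m′ x                       ∎

    powℤ-+ : ∀ i j x → powℤ n σ (i ℤ.+ j) x ≈ powℤ n σ i (powℤ n σ j x)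
    powℤ-+ i j x = begin
      powℤ n σ (i ℤ.+ j) x                    ≡⟨ powℤ≡iter (i ℤ.+ j) x ⟩
      iter σ (exponent (i ℤ.+ j)) x           ≈⟨ iter-congruent (wraps i ℕ.+ wraps j) (wraps (i ℤ.+ j)) (exponent-+ i j) x ⟩
      iter σ (exponent i ℕ.+ exponent j) x    ≡⟨ iter-+ σ (exponent i) (exponent j) x ⟩
      iter σ (exponent i) (iter σ (exponent j) x)
        ≡⟨ ≡.trans (powℤ≡iter i _) (≡.cong (iter σ (exponent i)) (powℤ≡iter j x)) ⟨
      powℤ n σ i (powℤ n σ j x)               ∎

  module Action (G : ℤ → Carrier → Carrier) (G-mult : ∀ j → IsMultiplicative (G j))
                (G-+ : ∀ i j x → G (i ℤ.+ j) x ≈ G i (G j x)) where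
    module Gʲ j = IsMultiplicative (G-mult j)

    G-at : ∀ {i j} x → i ≡ j → G i x ≈ G j x
    G-at x i≡j = reflexive (≡.cong (λ k → G k x) i≡j)

    shift-relation : ∀ {D x y} → G D x * y ≈ G (+ 1) x * G D y →
                     ∀ t → G (t ℤ.+ D) x * G t y ≈ G (t ℤ.+ + 1) x * G (t ℤ.+ D) y
    shift-relation {D} {x} {y} rel t = begin
      G (t ℤ.+ D) x * G t y           ≈⟨ *-congʳ (G-+ t D x) ⟩
      G t (G D x) * G t y             ≈⟨ Gʲ.homo t _ _ ⟨
      G t (G D x * y)                 ≈⟨ Gʲ.cong t rel ⟩
      G t (G (+ 1) x * G D y)         ≈⟨ Gʲ.homo t _ _ ⟩
      G t (G (+ 1) x) * G t (G D y)   ≈⟨ *-cong (G-+ t (+ 1) x) (G-+ t D y) ⟨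
      G (t ℤ.+ + 1) x * G (t ℤ.+ D) y ∎

    shift-relation′ : ∀ {D x y} → G D x * y ≈ G (+ 1) x * G D y →
                      ∀ k → G (k ℤ.- + 1) x * G (k ℤ.- D ℤ.- + 1) y ≈ G (k ℤ.- D) x * G (k ℤ.- + 1) y
    shift-relation′ {D} {x} {y} rel k = begin
      G (k ℤ.- + 1) x * G t y          ≈⟨ *-congʳ (G-at x (t+D k D)) ⟨
      G (t ℤ.+ D) x * G t y            ≈⟨ shift-relation rel t ⟩
      G (t ℤ.+ + 1) x * G (t ℤ.+ D) y  ≈⟨ *-cong (G-at x (t+1 k D)) (G-at y (t+D k D)) ⟩
      G (k ℤ.- D) x * G (k ℤ.- + 1) y  ∎
      where
      t : ℤ
      t = k ℤ.- D ℤ.- + 1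
      t+D : ∀ k D → (k ℤ.- D ℤ.- + 1) ℤ.+ D ≡ k ℤ.- + 1
      t+D = solve-∀
      t+1 : ∀ k D → (k ℤ.- D ℤ.- + 1) ℤ.+ + 1 ≡ k ℤ.- D
      t+1 = solve-∀

    base-relation : ∀ m {x} → x ≉ 0# → G (+ (suc m ℕ.* suc m)) x ≈ G (+ 1) x →
      G (+ suc m) x * prodInv F (λ i → G (+ (i ℕ.* suc m)) x) m
        ≈ G (+ 1) x * G (+ suc m) (prodInv F (λ i → G (+ (i ℕ.* suc m)) x) m)
    base-relation m {x} x≉0 G[d*d]≈G1 = begin
      G (+ d) x * P                   ≈⟨ *-comm _ _ ⟩
      P * G (+ d) x                   ≈⟨ *-congˡ (G-at x (≡.cong +_ (ℕP.*-identityˡ d))) ⟨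
      P * A 1                         ≈⟨ prodInv-telescope m A≉0 ⟩
      prodInv F (A ∘ suc) m * A d     ≈⟨ *-cong (sym G[d]P≈) G[d*d]≈G1 ⟩
      G (+ d) P * G (+ 1) x           ≈⟨ *-comm _ _ ⟩
      G (+ 1) x * G (+ d) P           ∎
      where
      d : ℕ
      d = suc m
      A : ℕ → Carrier
      A i = G (+ (i ℕ.* d)) x
      A≉0 : ∀ i → A i ≉ 0#
      A≉0 i = Gʲ.preserves-≉0 (+ (i ℕ.* d)) x≉0
      P : Carrier
      P = prodInv F A m
      G[d]P≈ : G (+ d) P ≈ prodInv F (A ∘ suc) m
      G[d]P≈ = trans (Gʲ.prodInv-homo (+ d) m A≉0) (prodInv-cong m (λ i → Gʲ.preserves-≉0 (+ d) (A≉0 i))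
        (λ i → trans (sym (G-+ (+ d) (+ (i ℕ.* d)) x)) (G-at x (≡.sym (ℤP.pos-+ d (i ℕ.* d))))))

  -- Each use of quotient-shift cancels the top factor of the product against
  -- β and lowers the index of β by D.
  module Telescope (α β : ℤ → Carrier) (α≉0 : ∀ t → α t ≉ 0#) (D : ℤ)
                   (relation : ∀ t → α (t ℤ.+ D) * β t ≈ α (t ℤ.+ + 1) * β (t ℤ.+ D)) where

    quotient-shift : ∀ t → β (t ℤ.+ D) * inv (α (t ℤ.+ D)) ≈ β t * inv (α (t ℤ.+ + 1))
    quotient-shift t = cross-divide (α≉0 _) (α≉0 _)
      (trans (*-comm _ _) (trans (sym (relation t)) (*-comm _ _)))

    β-at : ∀ {i j} → i ≡ j → β i ≈ β j
    β-at i≡j = reflexive (≡.cong β i≡j)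

    inv-α-at : ∀ {i j} → i ≡ j → inv (α i) ≈ inv (α j)
    inv-α-at i≡j = reflexive (≡.cong (inv ∘ α) i≡j)

    telescope : ∀ M u →
      β (D ℤ.* + suc M ℤ.+ u ℤ.- + 1) * prodInv F (λ i → α (+ i ℤ.* D ℤ.+ (u ℤ.- + 1))) (suc M)
        ≈ (inv (α u) * β (u ℤ.- + 1)) * prodInv F (λ i → α (+ i ℤ.* D ℤ.+ u)) M
    telescope zero u = begin
      β (D ℤ.* + 1 ℤ.+ u ℤ.- + 1) * (1# * inv (α (+ 1 ℤ.* D ℤ.+ (u ℤ.- + 1))))
        ≈⟨ *-cong (β-at (lhs-index D u)) (trans (*-identityˡ _) (inv-α-at (rhs-index D u))) ⟩
      β ((u ℤ.- + 1) ℤ.+ D) * inv (α ((u ℤ.- + 1) ℤ.+ D))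
        ≈⟨ quotient-shift (u ℤ.- + 1) ⟩
      β (u ℤ.- + 1) * inv (α ((u ℤ.- + 1) ℤ.+ + 1))
        ≈⟨ *-comm _ _ ⟩
      inv (α ((u ℤ.- + 1) ℤ.+ + 1)) * β (u ℤ.- + 1)
        ≈⟨ *-congʳ (inv-α-at (u-1+1 u)) ⟩
      inv (α u) * β (u ℤ.- + 1)
        ≈⟨ *-identityʳ _ ⟨
      inv (α u) * β (u ℤ.- + 1) * 1# ∎
      where
      lhs-index : ∀ D u → D ℤ.* + 1 ℤ.+ u ℤ.- + 1 ≡ (u ℤ.- + 1) ℤ.+ D
      lhs-index = solve-∀
      rhs-index : ∀ D u → + 1 ℤ.* D ℤ.+ (u ℤ.- + 1) ≡ (u ℤ.- + 1) ℤ.+ D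
      rhs-index = solve-∀
      u-1+1 : ∀ u → (u ℤ.- + 1) ℤ.+ + 1 ≡ u
      u-1+1 = solve-∀
    telescope (suc M) u = begin
      β (D ℤ.* + suc (suc M) ℤ.+ u ℤ.- + 1) * (P * inv (α (+ suc (suc M) ℤ.* D ℤ.+ (u ℤ.- + 1))))
        ≈⟨ *-cong (β-at (≡.trans (≡.cong (λ s → D ℤ.* s ℤ.+ u ℤ.- + 1) (ℤP.pos-+ 1 (suc M))) (lhs-index D S u)))
                  (*-congˡ (inv-α-at (≡.trans (≡.cong (λ s → s ℤ.* D ℤ.+ (u ℤ.- + 1)) (ℤP.pos-+ 1 (suc M))) (rhs-index D S u)))) ⟩
      β (t ℤ.+ D) * (P * inv (α (t ℤ.+ D)))
        ≈⟨ solve 3 (λ x p y → x ⊕ (p ⊕ y) ⊜ p ⊕ (x ⊕ y)) refl (β (t ℤ.+ D)) P (inv (α (t ℤ.+ D))) ⟩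
      P * (β (t ℤ.+ D) * inv (α (t ℤ.+ D)))
        ≈⟨ *-congˡ (quotient-shift t) ⟩
      P * (β t * inv (α (t ℤ.+ + 1)))
        ≈⟨ solve 3 (λ p x y → p ⊕ (x ⊕ y) ⊜ (x ⊕ p) ⊕ y) refl P (β t) (inv (α (t ℤ.+ + 1))) ⟩
      β t * P * inv (α (t ℤ.+ + 1))
        ≈⟨ *-cong (telescope M u) (inv-α-at (next-index D S u)) ⟩
      inv (α u) * β (u ℤ.- + 1) * Q * inv (α (+ suc M ℤ.* D ℤ.+ u))
        ≈⟨ *-assoc _ _ _ ⟩
      inv (α u) * β (u ℤ.- + 1) * (Q * inv (α (+ suc M ℤ.* D ℤ.+ u))) ∎
      where
      S t : ℤ
      S = + suc M
      t = D ℤ.* S ℤ.+ u ℤ.- + 1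
      P Q : Carrier
      P = prodInv F (λ i → α (+ i ℤ.* D ℤ.+ (u ℤ.- + 1))) (suc M)
      Q = prodInv F (λ i → α (+ i ℤ.* D ℤ.+ u)) M
      lhs-index : ∀ D S u → D ℤ.* (+ 1 ℤ.+ S) ℤ.+ u ℤ.- + 1 ≡ (D ℤ.* S ℤ.+ u ℤ.- + 1) ℤ.+ D
      lhs-index = solve-∀
      rhs-index : ∀ D S u → (+ 1 ℤ.+ S) ℤ.* D ℤ.+ (u ℤ.- + 1) ≡ (D ℤ.* S ℤ.+ u ℤ.- + 1) ℤ.+ D
      rhs-index = solve-∀
      next-index : ∀ D S u → (D ℤ.* S ℤ.+ u ℤ.- + 1) ℤ.+ + 1 ≡ S ℤ.* D ℤ.+ u
      next-index = solve-∀

    telescope-≤ : ∀ R u → u ℤ.≤ R ℤ.- + 1 →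
      β (D ℤ.* (R ℤ.- u) ℤ.+ u ℤ.- + 1) * prodInv F (λ i → α (+ i ℤ.* D ℤ.+ (u ℤ.- + 1))) ℤ.∣ R ℤ.- u ∣
        ≈ (inv (α u) * β (u ℤ.- + 1)) * prodInv F (λ i → α (+ i ℤ.* D ℤ.+ u)) ℤ.∣ R ℤ.- u ℤ.- + 1 ∣
    telescope-≤ R u u≤R-1 = ≡.subst Goal (≡.sym R-u≡+suc) (telescope M u)
      where
      Goal : ℤ → Set ℓ
      Goal S = β (D ℤ.* S ℤ.+ u ℤ.- + 1) * prodInv F (λ i → α (+ i ℤ.* D ℤ.+ (u ℤ.- + 1))) ℤ.∣ S ∣
                 ≈ (inv (α u) * β (u ℤ.- + 1)) * prodInv F (λ i → α (+ i ℤ.* D ℤ.+ u)) ℤ.∣ S ℤ.- + 1 ∣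
      reorder : ∀ R u → R ℤ.- + 1 ℤ.- u ≡ R ℤ.- u ℤ.- + 1
      reorder = solve-∀
      add-back : ∀ R u → R ℤ.- u ≡ + 1 ℤ.+ (R ℤ.- u ℤ.- + 1)
      add-back = solve-∀
      M : ℕ
      M = ℤ.∣ R ℤ.- u ℤ.- + 1 ∣
      M≡ : + M ≡ R ℤ.- u ℤ.- + 1
      M≡ = ℤP.0≤i⇒+∣i∣≡i (≡.subst (ℤ.0ℤ ℤ.≤_) (reorder R u) (ℤP.i≤j⇒0≤j-i u≤R-1))
      R-u≡+suc : R ℤ.- u ≡ + suc M
      R-u≡+suc = ≡.trans (add-back R u) (≡.trans (≡.cong (λ m → + 1 ℤ.+ m) (≡.sym M≡)) (≡.sym (ℤP.pos-+ 1 M)))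

lemma5p2 : ∀ {c ℓ} (F : Field c ℓ) (q d s : ℕ) →
  IsPrimePower q → 2 ℕ.≤ d →
  let open Field F
      n = d ℕ.* d ℕ.∸ 1
  in HasCard F (q ℕ.^ n) → gcd s n ≡ 1 →
  (a : Carrier) → ¬ (a ≈ 0#) →
  let σ : Carrier → Carrier
      σ x = x ^ (q ℕ.^ s)
      G : ℤ → Carrier → Carrier
      G = powℤ n σ
      b = prodInv F (λ i → G (+ (i ℕ.* d)) a) (d ℕ.∸ 1)
      r1 = + 1
      dz = + d
  in ((G dz a * b) ≈ (G r1 a * G dz b))
     × (∀ (k : ℤ) → dz ℤ.+ r1 ℤ.≤ k →
          (G (k ℤ.- r1) a * G (k ℤ.- dz ℤ.- r1) b)
            ≈ (G (k ℤ.- dz) a * G (k ℤ.- r1) b))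
     × (∀ (r : ℕ) → 1 ℕ.≤ r → r ℕ.≤ d ℕ.∸ 1 →
        ∀ (u : ℤ) → u ℤ.≤ + r ℤ.- r1 →
          (G (dz ℤ.* (+ r ℤ.- u) ℤ.+ u ℤ.- r1) b
             * prodInv F (λ i → G (+ i ℤ.* dz ℤ.+ (u ℤ.- r1)) a) ℤ.∣ + r ℤ.- u ∣)
          ≈ ((inv (G u a) * G (u ℤ.- r1) b)
             * prodInv F (λ i → G (+ i ℤ.* dz ℤ.+ u) a) ℤ.∣ + r ℤ.- u ℤ.- r1 ∣))
lemma5p2 F q zero            s _ ()           _    _ a a≉0
lemma5p2 F q (suc zero)      s _ (ℕ.s≤s ())   _    _ a a≉0
lemma5p2 F q d@(suc (suc d′)) s _ _           card _ a a≉0 =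
  base , (λ k _ → shift-relation′ base k) , (λ r _ _ u → telescope-≤ (+ r) u)
  where
  open Field F hiding (zero)
  open FieldProperties F
  -- d * d ∸ 1 reduces to suc n′
  n′ : ℕ
  n′ = d′ ℕ.+ suc d′ ℕ.* d
  σ : Carrier → Carrier
  σ x = x ^ (q ℕ.^ s)
  σ-period : ∀ x → iter σ (suc n′) x ≈ x
  σ-period = frobenius-period {n = suc n′} card s
  open Periodic (^-isMultiplicative (q ℕ.^ s)) n′ σ-period
  G : ℤ → Carrier → Carrier
  G = powℤ (suc n′) σ
  open Action G powℤ-isMultiplicative powℤ-+
  b : Carrier
  b = prodInv F (λ i → G (+ (i ℕ.* d)) a) (suc d′)
  base : G (+ d) a * b ≈ G (+ 1) a * G (+ d) b
  base = base-relation (suc d′) a≉0 (σ.cong (σ-period a))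
  open Telescope (λ t → G t a) (λ t → G t b) (λ t → Gʲ.preserves-≉0 t a≉0) (+ d) (shift-relation base)
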